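{- In $\mathrm{Free}(\mathcal E)$, an untwisted simple 1-morphism has no $f$ vertices.
   Context: $\mathcal E$ is the extended Frobenius presentation with object $C$ and generating 1-morphisms $m: C\boxtimes C\to C$, $u:1\to C$, $\cup: 1\to C\boxtimes C$, $f: C\to 1$, $\cap: C\boxtimes C\to 1$ (together with various 2-morphisms); $\mathrm{Free}(\mathcal E)$ is the free monoidal bicategory it generates. String diagrams are read bottom to top: $m$ has two input wires below and one output above, $u$ one output, $f$ one input below, $\cup$ two outputs, $\cap$ two inputs. A 1-morphism is simple if its string diagram graph is connected and acyclic and it has a unique output wire. For an $m$, $u$ or $f$ vertex $v$, the twistedness $\mathrm{Tw}(v)$ is the number of right turns minus the number of left turns along the shortest path from $v$ to the unique output wire (turns occur at cups and caps, and when passing through an $m$ vertex from one input leg to the other); the 1-morphism is untwisted if every such $v$ has $\mathrm{Tw}(v)=0$. -}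

module Defs where

open import Data.Nat using (ℕ; zero; suc; _+_; _≤_; _<ᵇ_)
open import Data.Fin using (Fin; zero; suc; toℕ; _↑ˡ_; _↑ʳ_)
open import Data.Unit using (⊤; tt)
open import Data.Empty using (⊥)
open import Data.Sum using (_⊎_; inj₁; inj₂)
open import Data.Product using (Σ; _×_; _,_; proj₁; proj₂)
open import Data.Bool using (Bool; true; false; if_then_else_)
open import Data.List using (List; []; _∷_)
open import Data.Integer as ℤ using (ℤ; +_; -[1+_])
open import Relation.Binary.PropositionalEquality using (_≡_; _≢_)
open import Data.List.Relation.Unary.Unique.Propositional using (Unique)

-- Generating 1-morphisms of the extended Frobenius presentation E.
-- Objects of Free(E) are recorded by their number of C factors
-- (structural 1-cells: associators/unitors are invisible in string diagrams).

data Gen : Set where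
  gm gu gf gcup gcap : Gen

ins : Gen → ℕ          -- number of input wires (below)
ins gm   = 2
ins gu   = 0
ins gf   = 1
ins gcup = 0
ins gcap = 2

outs : Gen → ℕ         -- number of output wires (above)
outs gm   = 1
outs gu   = 1
outs gf   = 0
outs gcup = 2
outs gcap = 0

-- 1-morphisms of Free(E) as formal composites (string-diagram terms)
-- Tm n k : C^{⊠n} → C^{⊠k}
infixr 9 _⊚_
infixr 8 _⊠_
data Tm : ℕ → ℕ → Set where
  gen  : (g : Gen) → Tm (ins g) (outs g)
  idt  : (n : ℕ) → Tm n n
  _⊚_  : ∀ {n k l} → Tm k l → Tm n k → Tm n l                -- s ⊚ t : t below, s above
  _⊠_  : ∀ {a b c d} → Tm a b → Tm c d → Tm (a + c) (b + d)

-- The string diagram graph.  Nodes: generator vertices, and "points"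
-- (boundary points of every (sub)term, i.e. a subdivision of the wires).

data Kind : Set where
  gen : Gen → Kind
  pt  : Kind

kIn : Kind → ℕ
kIn (gen g) = ins g
kIn pt      = 1

kOut : Kind → ℕ
kOut (gen g) = outs g
kOut pt      = 1

-- a leg of a node: an input leg (below) or an output leg (above),
-- numbered from left to right
data Leg (a b : ℕ) : Set where
  lin  : Fin a → Leg a b
  lout : Fin b → Leg a b

Inner : ∀ {n k} → Tm n k → Set
Inner (gen g)              = ⊤
Inner (idt n)              = ⊥
Inner (_⊚_ {k = k} s t)    = Inner s ⊎ (Inner t ⊎ Fin k)
Inner (s ⊠ t)              = Inner s ⊎ Inner t

ikind : ∀ {n k} (t : Tm n k) → Inner t → Kind
ikind (gen g) _                  = gen g
ikind (idt n) ()
ikind (s ⊚ t) (inj₁ x)           = ikind s x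
ikind (s ⊚ t) (inj₂ (inj₁ x))    = ikind t x
ikind (s ⊚ t) (inj₂ (inj₂ j))    = pt
ikind (s ⊠ t) (inj₁ x)           = ikind s x
ikind (s ⊠ t) (inj₂ x)           = ikind t x

data Node {n k : ℕ} (t : Tm n k) : Set where
  bin  : Fin n → Node t
  bout : Fin k → Node t
  inn  : Inner t → Node t

kind : ∀ {n k} {t : Tm n k} → Node t → Kind
kind (bin _)      = pt
kind (bout _)     = pt
kind {t = t} (inn x) = ikind t x

LegAt : ∀ {n k} (t : Tm n k) → Node t → Set
LegAt t x = Leg (kIn (kind x)) (kOut (kind x))

Port : ∀ {n k} → Tm n k → Set
Port t = Σ (Node t) (LegAt t)

Edge : ∀ {n k} → Tm n k → Set
Edge (gen g) = Fin (ins g) ⊎ Fin (outs g)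
Edge (idt n) = Fin n
Edge (s ⊚ t) = Edge s ⊎ Edge t
Edge (s ⊠ t) = Edge s ⊎ Edge t

upperP : ∀ {n k l} (s : Tm k l) (t : Tm n k) → Port s → Port (s ⊚ t)
upperP s t (bin j , ℓ)  = inn (inj₂ (inj₂ j)) , ℓ
upperP s t (bout j , ℓ) = bout j , ℓ
upperP s t (inn x , ℓ)  = inn (inj₁ x) , ℓ

lowerP : ∀ {n k l} (s : Tm k l) (t : Tm n k) → Port t → Port (s ⊚ t)
lowerP s t (bin i , ℓ)  = bin i , ℓ
lowerP s t (bout j , ℓ) = inn (inj₂ (inj₂ j)) , ℓ
lowerP s t (inn x , ℓ)  = inn (inj₂ (inj₁ x)) , ℓ

leftP : ∀ {a b c d} (s : Tm a b) (t : Tm c d) → Port s → Port (s ⊠ t)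
leftP {c = c} s t (bin i , ℓ)  = bin (i ↑ˡ c) , ℓ
leftP {d = d} s t (bout j , ℓ) = bout (j ↑ˡ d) , ℓ
leftP s t (inn x , ℓ)          = inn (inj₁ x) , ℓ

rightP : ∀ {a b c d} (s : Tm a b) (t : Tm c d) → Port t → Port (s ⊠ t)
rightP {a = a} s t (bin i , ℓ)  = bin (a ↑ʳ i) , ℓ
rightP {b = b} s t (bout j , ℓ) = bout (b ↑ʳ j) , ℓ
rightP s t (inn x , ℓ)          = inn (inj₂ x) , ℓ

pmap : ∀ {A B : Set} → (A → B) → A × A → B × B
pmap φ (p , q) = φ p , φ q

ends : ∀ {n k} (t : Tm n k) → Edge t → Port t × Port t
ends (gen g) (inj₁ i) = (bin i , lout zero) , (inn tt , lin i)
ends (gen g) (inj₂ j) = (inn tt , lout j) , (bout j , lin zero)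
ends (idt n) i        = (bin i , lout zero) , (bout i , lin zero)
ends (s ⊚ t) (inj₁ e) = pmap (upperP s t) (ends s e)
ends (s ⊚ t) (inj₂ e) = pmap (lowerP s t) (ends t e)
ends (s ⊠ t) (inj₁ e) = pmap (leftP s t) (ends s e)
ends (s ⊠ t) (inj₂ e) = pmap (rightP s t) (ends t e)

Dart : ∀ {n k} → Tm n k → Set
Dart t = Edge t × Bool

dsrc : ∀ {n k} (t : Tm n k) → Dart t → Port t
dsrc t (e , true)  = proj₁ (ends t e)
dsrc t (e , false) = proj₂ (ends t e)

dtgt : ∀ {n k} (t : Tm n k) → Dart t → Port t
dtgt t (e , true)  = proj₂ (ends t e)
dtgt t (e , false) = proj₁ (ends t e)

data Walk {n k : ℕ} (t : Tm n k) : Node t → Node t → Set where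
  nil  : ∀ {x} → Walk t x x
  cons : ∀ {x y} (d : Dart t) → proj₁ (dsrc t d) ≡ x →
         Walk t (proj₁ (dtgt t d)) y → Walk t x y

len : ∀ {n k} {t : Tm n k} {x y} → Walk t x y → ℕ
len nil          = 0
len (cons _ _ w) = suc (len w)

edgesOf : ∀ {n k} {t : Tm n k} {x y} → Walk t x y → List (Edge t)
edgesOf nil          = []
edgesOf (cons d _ w) = proj₁ d ∷ edgesOf w

nodesOf : ∀ {n k} {t : Tm n k} {x y} → Walk t x y → List (Node t)
nodesOf nil                = []
nodesOf (cons {x = x} _ _ w) = x ∷ nodesOf w

-- Entering a node through leg ℓ and leaving it through leg ℓ'.
-- Both input legs (cap, or m from one input to the other): arriving going
-- up and leaving going down; left-to-right is a right turn (+1).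
-- Both output legs (cup): arriving going down and leaving going up;
-- right-to-left is a right turn (+1).

cmpSign : ℕ → ℕ → ℤ
cmpSign i j = if i <ᵇ j then + 1 else (if j <ᵇ i then -[1+ 0 ] else + 0)

turnLeg : ∀ {a b c d} → Leg a b → Leg c d → ℤ
turnLeg (lin i)  (lin j)  = cmpSign (toℕ i) (toℕ j)
turnLeg (lout i) (lout j) = cmpSign (toℕ j) (toℕ i)
turnLeg _ _               = + 0

-- right turns minus left turns along a walk (turns at intermediate nodes)
tw : ∀ {n k} {t : Tm n k} {x y} → Walk t x y → ℤ
tw nil                          = + 0
tw (cons d p nil)               = + 0
tw {t = t} (cons d p (cons d' q w)) =
  turnLeg (proj₂ (dtgt t d)) (proj₂ (dsrc t d')) ℤ.+ tw (cons d' q w)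

Connected : ∀ {n k} → Tm n k → Set
Connected t = ∀ x y → Walk t x y

Acyclic : ∀ {n k} → Tm n k → Set
Acyclic t = ∀ x (w : Walk t x x) → 1 ≤ len w →
            Unique (edgesOf w) → Unique (nodesOf w) → ⊥

Simple : ∀ {n k} → Tm n k → Set
Simple {k = k} t = Connected t × Acyclic t × (k ≡ 1)

Shortest : ∀ {n k} {t : Tm n k} {x y} → Walk t x y → Set
Shortest {t = t} {x} {y} w = (w' : Walk t x y) → len w ≤ len w'

IsMUF : Kind → Set
IsMUF (gen gm) = ⊤
IsMUF (gen gu) = ⊤
IsMUF (gen gf) = ⊤
IsMUF _        = ⊥

Untwisted : ∀ {n} → Tm n 1 → Set
Untwisted t = (x : Inner t) → IsMUF (ikind t x) →
              (w : Walk t (inn x) (bout zero)) → Shortest w → tw w ≡ + 0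

HasNoF : ∀ {n k} → Tm n k → Set
HasNoF t = (x : Inner t) → ikind t x ≢ gen gf

-- Give each dart a direction, up or down.  At a node a walk turns (by ±1) exactly
-- when its direction reverses there, i.e. when it arrives and leaves through two
-- input legs or two output legs; the only exception is retracing the wire it came
-- along, which a shortest path never does since every port carries at most one wire.
-- So along a shortest path Tw is odd iff the first and last directions differ.  A path
-- from an f vertex must start downwards, f having no output legs, and reaches the
-- output wire going upwards: Tw(f) is odd, hence nonzero.
module Submission where

open import Defs
open import Data.Bool using (Bool; true; false; not; _xor_)
open import Data.Bool.Properties
  using (not-involutive; not-injective; not-distribˡ-xor; xor-annihilates-not;
         xor-assoc; xor-comm; xor-same; xor-identityʳ)
open import Data.Empty using (⊥; ⊥-elim)
open import Data.Fin using (zero; toℕ; _↑ˡ_; _↑ʳ_; splitAt)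
open import Data.Fin.Properties using (toℕ-injective; splitAt-↑ˡ; splitAt-↑ʳ)
open import Data.Integer as ℤ using (ℤ; +_; -[1+_]; _⊖_)
open import Data.Integer.Properties using ([1+m]⊖[1+n]≡m⊖n)
open import Data.Maybe using (Maybe; just; nothing)
open import Data.Maybe.Properties using (just-injective)
open import Data.Nat as ℕ using (ℕ; zero; suc; _≤_; _<_; s≤s)
open import Data.Nat.Induction using (<-rec)
open import Data.Nat.Properties using (<⇒≱; ≮⇒≥; n<1+n; m<n⇒m<1+n)
open import Data.Product using (Σ; _×_; _,_; proj₁; proj₂; map₁)
open import Data.Sum as Sum using (_⊎_; inj₁; inj₂)
open import Data.Sum.Properties using (inj₁-injective; inj₂-injective)
open import Data.Unit using (⊤; tt)
open import Function using (_∘_)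
open import Relation.Binary.PropositionalEquality
open import Relation.Nullary using (¬_; contradiction)
open ≡-Reasoning

isOdd : ℕ → Bool
isOdd zero    = false
isOdd (suc n) = not (isOdd n)

isOddℤ : ℤ → Bool
isOddℤ (+ n)    = isOdd n
isOddℤ -[1+ n ] = not (isOdd n)

isOdd-+ : ∀ m n → isOdd (m ℕ.+ n) ≡ isOdd m xor isOdd n
isOdd-+ zero    n = refl
isOdd-+ (suc m) n = trans (cong not (isOdd-+ m n)) (not-distribˡ-xor (isOdd m) (isOdd n))

isOddℤ-⊖ : ∀ m n → isOddℤ (m ⊖ n) ≡ isOdd m xor isOdd n
isOddℤ-⊖ zero    zero    = refl
isOddℤ-⊖ zero    (suc n) = refl
isOddℤ-⊖ (suc m) zero    = sym (xor-identityʳ _)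
isOddℤ-⊖ (suc m) (suc n) = begin
  isOddℤ (suc m ⊖ suc n)          ≡⟨ cong isOddℤ ([1+m]⊖[1+n]≡m⊖n m n) ⟩
  isOddℤ (m ⊖ n)                  ≡⟨ isOddℤ-⊖ m n ⟩
  isOdd m xor isOdd n             ≡⟨ xor-annihilates-not (isOdd m) (isOdd n) ⟨
  not (isOdd m) xor not (isOdd n) ∎

isOddℤ-+ : ∀ i j → isOddℤ (i ℤ.+ j) ≡ isOddℤ i xor isOddℤ j
isOddℤ-+ (+ m)    (+ n)    = isOdd-+ m n
isOddℤ-+ (+ m)    -[1+ n ] = isOddℤ-⊖ m (suc n)
isOddℤ-+ -[1+ m ] (+ n)    = trans (isOddℤ-⊖ n (suc m)) (xor-comm (isOdd n) _)
isOddℤ-+ -[1+ m ] -[1+ n ] = begin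
  not (not (isOdd (m ℕ.+ n)))     ≡⟨ not-involutive _ ⟩
  isOdd (m ℕ.+ n)                 ≡⟨ isOdd-+ m n ⟩
  isOdd m xor isOdd n             ≡⟨ xor-annihilates-not (isOdd m) (isOdd n) ⟨
  not (isOdd m) xor not (isOdd n) ∎

xor-cancel-middle : ∀ a b c → (a xor b) xor (b xor c) ≡ a xor c
xor-cancel-middle a b c = begin
  (a xor b) xor (b xor c) ≡⟨ xor-assoc a b (b xor c) ⟩
  a xor (b xor (b xor c)) ≡⟨ cong (a xor_) (xor-assoc b b c) ⟨
  a xor ((b xor b) xor c) ≡⟨ cong (λ z → a xor (z xor c)) (xor-same b) ⟩
  a xor c                 ∎

cmpSign-isOdd : ∀ {m n} → m ≢ n → isOddℤ (cmpSign m n) ≡ true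
cmpSign-isOdd {zero}  {zero}  m≢n = ⊥-elim (m≢n refl)
cmpSign-isOdd {zero}  {suc n} _   = refl
cmpSign-isOdd {suc m} {zero}  _   = refl
cmpSign-isOdd {suc m} {suc n} m≢n = cmpSign-isOdd (m≢n ∘ cong suc)

¬¬-least : ∀ {P : ℕ → Set} {n} → P n → ¬ ¬ (Σ ℕ λ m → P m × (∀ k → P k → m ≤ k))
¬¬-least {P} {n} pn no-least = <-rec (λ i → ¬ P i) below-least n pn
  where
  below-least : ∀ i → (∀ {j} → j < i → ¬ P j) → ¬ P i
  below-least i below pi = no-least (i , pi , λ j pj → ≮⇒≥ (λ j<i → below j<i pj))

isIn : ∀ {a b} → Leg a b → Bool
isIn (lin _)  = true
isIn (lout _) = false

legIdx : ∀ {a b} → Leg a b → ℕ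
legIdx (lin i)  = toℕ i
legIdx (lout j) = toℕ j

legKey : ∀ {a b} → Leg a b → Bool × ℕ
legKey ℓ = isIn ℓ , legIdx ℓ

-- A walk arrives at leg ℓ travelling upwards iff ℓ is an input leg, and leaves
-- through ℓ' travelling upwards iff ℓ' is an output leg: a turn is made exactly
-- when the direction of travel reverses.
turnLeg-isOdd : ∀ {a b c d} (ℓ : Leg a b) (ℓ' : Leg c d) → legKey ℓ ≢ legKey ℓ' →
                isOddℤ (turnLeg ℓ ℓ') ≡ isIn ℓ xor not (isIn ℓ')
turnLeg-isOdd (lin i)  (lin j)  ℓ≢ℓ' = cmpSign-isOdd (ℓ≢ℓ' ∘ cong (true ,_))
turnLeg-isOdd (lout i) (lout j) ℓ≢ℓ' = cmpSign-isOdd (ℓ≢ℓ' ∘ cong (false ,_) ∘ sym)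
turnLeg-isOdd (lin i)  (lout j) _    = refl
turnLeg-isOdd (lout i) (lin j)  _    = refl

PortKey : ∀ {n k} → Tm n k → Set
PortKey t = Node t × Bool × ℕ

portKey : ∀ {n k} {t : Tm n k} → Port t → PortKey t
portKey (x , ℓ) = x , legKey ℓ

NotInput NotOutput : ∀ {n k} {t : Tm n k} → Node t → Set
NotInput (bin _) = ⊥
NotInput _       = ⊤
NotOutput (bout _) = ⊥
NotOutput _        = ⊤

-- Where a dart can start; the direction true means travelling upwards.
Departs : ∀ {n k} {t : Tm n k} → PortKey t → Bool → Set
Departs (x , i , _) true  = NotOutput x × i ≡ false
Departs (x , i , _) false = NotInput x × i ≡ true

injective-from-retract : ∀ {A B C : Set} {f : A → B} {g : A → C} (r : B → C) →
                         (∀ x → r (f x) ≡ g x) → (∀ {x y} → g x ≡ g y → x ≡ y) →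
                         ∀ {x y} → f x ≡ f y → x ≡ y
injective-from-retract r rf≡g g-inj {x} {y} fx≡fy =
  g-inj (trans (sym (rf≡g x)) (trans (cong r fx≡fy) (rf≡g y)))

record PortEmbedding {n k n' k'} (s : Tm n k) (t : Tm n' k') : Set where
  field
    edge           : Edge s → Edge t
    port           : Port s → Port t
    node           : Node s → Node t
    ends-edge      : ∀ e → ends t (edge e) ≡ pmap port (ends s e)
    portKey-port   : ∀ P → portKey (port P) ≡ map₁ node (portKey P)
    node-injective : ∀ {x y} → node x ≡ node y → x ≡ y
    node-NotInput  : ∀ x → NotInput x → NotInput (node x)
    node-NotOutput : ∀ x → NotOutput x → NotOutput (node x)

  portKey-dsrc-edge : ∀ e b → portKey (dsrc t (edge e , b)) ≡ map₁ node (portKey (dsrc s (e , b)))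
  portKey-dsrc-edge e true  = trans (cong (portKey ∘ proj₁) (ends-edge e)) (portKey-port _)
  portKey-dsrc-edge e false = trans (cong (portKey ∘ proj₂) (ends-edge e)) (portKey-port _)

  node-dsrc-edge : ∀ e b → proj₁ (dsrc t (edge e , b)) ≡ node (proj₁ (dsrc s (e , b)))
  node-dsrc-edge e b = cong proj₁ (portKey-dsrc-edge e b)

  departs-edge : ∀ e b → Departs (portKey (dsrc s (e , b))) b → Departs (portKey (dsrc t (edge e , b))) b
  departs-edge e b D = subst (λ K → Departs K b) (sym (portKey-dsrc-edge e b)) (departs-node b _ D)
    where
    departs-node : ∀ b K → Departs K b → Departs (map₁ node K) b
    departs-node true  (x , _) (x-ok , i≡) = node-NotOutput x x-ok , i≡
    departs-node false (x , _) (x-ok , i≡) = node-NotInput x x-ok , i≡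

  portKey-dsrc-edge-injective : ∀ b {e e'} → portKey (dsrc t (edge e , b)) ≡ portKey (dsrc t (edge e' , b)) →
                                portKey (dsrc s (e , b)) ≡ portKey (dsrc s (e' , b))
  portKey-dsrc-edge-injective b {e} {e'} eq = cong₂ _,_ (node-injective (cong proj₁ eq')) (cong proj₂ eq')
    where
    eq' : map₁ node (portKey (dsrc s (e , b))) ≡ map₁ node (portKey (dsrc s (e' , b)))
    eq' = trans (sym (portKey-dsrc-edge e b)) (trans eq (portKey-dsrc-edge e' b))

module _ {n k l} (s : Tm k l) (t : Tm n k) where
  upperNode : Node s → Node (s ⊚ t)
  upperNode (bin j)  = inn (inj₂ (inj₂ j))
  upperNode (bout j) = bout j
  upperNode (inn x)  = inn (inj₁ x)

  lowerNode : Node t → Node (s ⊚ t)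
  lowerNode (bin i)  = bin i
  lowerNode (bout j) = inn (inj₂ (inj₂ j))
  lowerNode (inn x)  = inn (inj₂ (inj₁ x))

  fromUpper : Node (s ⊚ t) → Maybe (Node s)
  fromUpper (bin _)                = nothing
  fromUpper (bout j)               = just (bout j)
  fromUpper (inn (inj₁ x))         = just (inn x)
  fromUpper (inn (inj₂ (inj₁ _)))  = nothing
  fromUpper (inn (inj₂ (inj₂ j)))  = just (bin j)

  fromLower : Node (s ⊚ t) → Maybe (Node t)
  fromLower (bin i)                = just (bin i)
  fromLower (bout _)               = nothing
  fromLower (inn (inj₁ _))         = nothing
  fromLower (inn (inj₂ (inj₁ x)))  = just (inn x)
  fromLower (inn (inj₂ (inj₂ j)))  = just (bout j)

  fromUpper-upperNode : ∀ x → fromUpper (upperNode x) ≡ just x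
  fromUpper-upperNode (bin _)  = refl
  fromUpper-upperNode (bout _) = refl
  fromUpper-upperNode (inn _)  = refl

  fromLower-lowerNode : ∀ y → fromLower (lowerNode y) ≡ just y
  fromLower-lowerNode (bin _)  = refl
  fromLower-lowerNode (bout _) = refl
  fromLower-lowerNode (inn _)  = refl

  fromUpper-lowerNode : ∀ y → NotOutput y → fromUpper (lowerNode y) ≡ nothing
  fromUpper-lowerNode (bin _) _ = refl
  fromUpper-lowerNode (inn _) _ = refl

  fromLower-upperNode : ∀ x → NotInput x → fromLower (upperNode x) ≡ nothing
  fromLower-upperNode (bout _) _ = refl
  fromLower-upperNode (inn _)  _ = refl

  -- The halves of s ⊚ t share only the points gluing the inputs of s to the outputs of t.
  upperNode≢lowerNode : ∀ x y → NotInput x ⊎ NotOutput y → upperNode x ≢ lowerNode y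
  upperNode≢lowerNode x y (inj₁ x-ok) eq
    with trans (sym (fromLower-upperNode x x-ok)) (trans (cong fromLower eq) (fromLower-lowerNode y))
  ... | ()
  upperNode≢lowerNode x y (inj₂ y-ok) eq
    with trans (sym (fromUpper-upperNode x)) (trans (cong fromUpper eq) (fromUpper-lowerNode y y-ok))
  ... | ()

  upper : PortEmbedding s (s ⊚ t)
  upper = record
    { edge           = inj₁
    ; port           = upperP s t
    ; node           = upperNode
    ; ends-edge      = λ _ → refl
    ; portKey-port   = λ { (bin _ , _) → refl ; (bout _ , _) → refl ; (inn _ , _) → refl }
    ; node-injective = injective-from-retract fromUpper fromUpper-upperNode just-injective
    ; node-NotInput  = λ { (bin _) _ → tt ; (bout _) _ → tt ; (inn _) _ → tt }
    ; node-NotOutput = λ { (bin _) _ → tt ; (inn _) _ → tt }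
    }

  lower : PortEmbedding t (s ⊚ t)
  lower = record
    { edge           = inj₂
    ; port           = lowerP s t
    ; node           = lowerNode
    ; ends-edge      = λ _ → refl
    ; portKey-port   = λ { (bin _ , _) → refl ; (bout _ , _) → refl ; (inn _ , _) → refl }
    ; node-injective = injective-from-retract fromLower fromLower-lowerNode just-injective
    ; node-NotInput  = λ { (bout _) _ → tt ; (inn _) _ → tt }
    ; node-NotOutput = λ { (bin _) _ → tt ; (bout _) _ → tt ; (inn _) _ → tt }
    }

module _ {a b c d} (s : Tm a b) (t : Tm c d) where
  leftNode : Node s → Node (s ⊠ t)
  leftNode (bin i)  = bin (i ↑ˡ c)
  leftNode (bout j) = bout (j ↑ˡ d)
  leftNode (inn x)  = inn (inj₁ x)

  rightNode : Node t → Node (s ⊠ t)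
  rightNode (bin i)  = bin (a ↑ʳ i)
  rightNode (bout j) = bout (b ↑ʳ j)
  rightNode (inn x)  = inn (inj₂ x)

  splitNode : Node (s ⊠ t) → Node s ⊎ Node t
  splitNode (bin i)  = Sum.map bin bin (splitAt a i)
  splitNode (bout j) = Sum.map bout bout (splitAt b j)
  splitNode (inn x)  = Sum.map inn inn x

  splitNode-leftNode : ∀ x → splitNode (leftNode x) ≡ inj₁ x
  splitNode-leftNode (bin i)  = cong (Sum.map bin bin) (splitAt-↑ˡ a i c)
  splitNode-leftNode (bout j) = cong (Sum.map bout bout) (splitAt-↑ˡ b j d)
  splitNode-leftNode (inn _)  = refl

  splitNode-rightNode : ∀ y → splitNode (rightNode y) ≡ inj₂ y
  splitNode-rightNode (bin i)  = cong (Sum.map bin bin) (splitAt-↑ʳ a c i)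
  splitNode-rightNode (bout j) = cong (Sum.map bout bout) (splitAt-↑ʳ b d j)
  splitNode-rightNode (inn _)  = refl

  leftNode≢rightNode : ∀ x y → leftNode x ≢ rightNode y
  leftNode≢rightNode x y eq
    with trans (sym (splitNode-leftNode x)) (trans (cong splitNode eq) (splitNode-rightNode y))
  ... | ()

  left : PortEmbedding s (s ⊠ t)
  left = record
    { edge           = inj₁
    ; port           = leftP s t
    ; node           = leftNode
    ; ends-edge      = λ _ → refl
    ; portKey-port   = λ { (bin _ , _) → refl ; (bout _ , _) → refl ; (inn _ , _) → refl }
    ; node-injective = injective-from-retract splitNode splitNode-leftNode inj₁-injective
    ; node-NotInput  = λ { (bout _) _ → tt ; (inn _) _ → tt }
    ; node-NotOutput = λ { (bin _) _ → tt ; (inn _) _ → tt }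
    }

  right : PortEmbedding t (s ⊠ t)
  right = record
    { edge           = inj₂
    ; port           = rightP s t
    ; node           = rightNode
    ; ends-edge      = λ _ → refl
    ; portKey-port   = λ { (bin _ , _) → refl ; (bout _ , _) → refl ; (inn _ , _) → refl }
    ; node-injective = injective-from-retract splitNode splitNode-rightNode inj₂-injective
    ; node-NotInput  = λ { (bout _) _ → tt ; (inn _) _ → tt }
    ; node-NotOutput = λ { (bin _) _ → tt ; (inn _) _ → tt }
    }

open PortEmbedding using (node-dsrc-edge; departs-edge; portKey-dsrc-edge-injective)

departs-dsrc : ∀ {n k} (t : Tm n k) (d : Dart t) → Departs (portKey (dsrc t d)) (proj₂ d)
departs-dsrc (gen g) (inj₁ _ , true)  = tt , refl
departs-dsrc (gen g) (inj₁ _ , false) = tt , refl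
departs-dsrc (gen g) (inj₂ _ , true)  = tt , refl
departs-dsrc (gen g) (inj₂ _ , false) = tt , refl
departs-dsrc (idt n) (_ , true)       = tt , refl
departs-dsrc (idt n) (_ , false)      = tt , refl
departs-dsrc (s ⊚ t) (inj₁ e , b) = departs-edge (upper s t) e b (departs-dsrc s (e , b))
departs-dsrc (s ⊚ t) (inj₂ e , b) = departs-edge (lower s t) e b (departs-dsrc t (e , b))
departs-dsrc (s ⊠ t) (inj₁ e , b) = departs-edge (left s t) e b (departs-dsrc s (e , b))
departs-dsrc (s ⊠ t) (inj₂ e , b) = departs-edge (right s t) e b (departs-dsrc t (e , b))

dsrc-isIn : ∀ {n k} (t : Tm n k) (d : Dart t) → isIn (proj₂ (dsrc t d)) ≡ not (proj₂ d)
dsrc-isIn t (e , true)  = proj₂ (departs-dsrc t (e , true))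
dsrc-isIn t (e , false) = proj₂ (departs-dsrc t (e , false))

dtgt-isIn : ∀ {n k} (t : Tm n k) (d : Dart t) → isIn (proj₂ (dtgt t d)) ≡ proj₂ d
dtgt-isIn t (e , true)  = dsrc-isIn t (e , false)
dtgt-isIn t (e , false) = dsrc-isIn t (e , true)

dtgt-bout⇒up : ∀ {n k} (t : Tm n k) (d : Dart t) {j} → proj₁ (dtgt t d) ≡ bout j → proj₂ d ≡ true
dtgt-bout⇒up t (e , true)  _  = refl
dtgt-bout⇒up t (e , false) eq = ⊥-elim (subst NotOutput eq (proj₁ (departs-dsrc t (e , true))))

upper-dsrc≢lower-dsrc : ∀ {n k l} (s : Tm k l) (t : Tm n k) b e e' →
                        proj₁ (dsrc (s ⊚ t) (inj₁ e , b)) ≢ proj₁ (dsrc (s ⊚ t) (inj₂ e' , b))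
upper-dsrc≢lower-dsrc s t b e e' eq =
  upperNode≢lowerNode s t _ _ (not-glued b)
    (trans (sym (node-dsrc-edge (upper s t) e b))
           (trans eq (node-dsrc-edge (lower s t) e' b)))
  where
  not-glued : ∀ b → NotInput (proj₁ (dsrc s (e , b))) ⊎ NotOutput (proj₁ (dsrc t (e' , b)))
  not-glued true  = inj₂ (proj₁ (departs-dsrc t (e' , true)))
  not-glued false = inj₁ (proj₁ (departs-dsrc s (e , false)))

left-dsrc≢right-dsrc : ∀ {m₁ n₁ m₂ n₂} (s : Tm m₁ n₁) (t : Tm m₂ n₂) b e e' →
                       proj₁ (dsrc (s ⊠ t) (inj₁ e , b)) ≢ proj₁ (dsrc (s ⊠ t) (inj₂ e' , b))
left-dsrc≢right-dsrc s t b e e' eq =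
  leftNode≢rightNode s t _ _
    (trans (sym (node-dsrc-edge (left s t) e b))
           (trans eq (node-dsrc-edge (right s t) e' b)))

dsrc-edge-injective : ∀ {n k} (t : Tm n k) b {e e'} →
                      portKey (dsrc t (e , b)) ≡ portKey (dsrc t (e' , b)) → e ≡ e'
dsrc-edge-injective (gen g) true  {inj₁ _} {inj₁ _} refl = refl
dsrc-edge-injective (gen g) true  {inj₁ _} {inj₂ _} ()
dsrc-edge-injective (gen g) true  {inj₂ _} {inj₁ _} ()
dsrc-edge-injective (gen g) true  {inj₂ _} {inj₂ _} eq   = cong inj₂ (toℕ-injective (cong (proj₂ ∘ proj₂) eq))
dsrc-edge-injective (gen g) false {inj₁ _} {inj₁ _} eq   = cong inj₁ (toℕ-injective (cong (proj₂ ∘ proj₂) eq))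
dsrc-edge-injective (gen g) false {inj₁ _} {inj₂ _} ()
dsrc-edge-injective (gen g) false {inj₂ _} {inj₁ _} ()
dsrc-edge-injective (gen g) false {inj₂ _} {inj₂ _} refl = refl
dsrc-edge-injective (idt n) true  refl = refl
dsrc-edge-injective (idt n) false refl = refl
dsrc-edge-injective (s ⊚ t) b {inj₁ _} {inj₁ _} eq =
  cong inj₁ (dsrc-edge-injective s b (portKey-dsrc-edge-injective (upper s t) b eq))
dsrc-edge-injective (s ⊚ t) b {inj₂ _} {inj₂ _} eq =
  cong inj₂ (dsrc-edge-injective t b (portKey-dsrc-edge-injective (lower s t) b eq))
dsrc-edge-injective (s ⊚ t) b {inj₁ e} {inj₂ e'} eq =
  ⊥-elim (upper-dsrc≢lower-dsrc s t b e e' (cong proj₁ eq))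
dsrc-edge-injective (s ⊚ t) b {inj₂ e} {inj₁ e'} eq =
  ⊥-elim (upper-dsrc≢lower-dsrc s t b e' e (cong proj₁ (sym eq)))
dsrc-edge-injective (s ⊠ t) b {inj₁ _} {inj₁ _} eq =
  cong inj₁ (dsrc-edge-injective s b (portKey-dsrc-edge-injective (left s t) b eq))
dsrc-edge-injective (s ⊠ t) b {inj₂ _} {inj₂ _} eq =
  cong inj₂ (dsrc-edge-injective t b (portKey-dsrc-edge-injective (right s t) b eq))
dsrc-edge-injective (s ⊠ t) b {inj₁ e} {inj₂ e'} eq =
  ⊥-elim (left-dsrc≢right-dsrc s t b e e' (cong proj₁ eq))
dsrc-edge-injective (s ⊠ t) b {inj₂ e} {inj₁ e'} eq =
  ⊥-elim (left-dsrc≢right-dsrc s t b e' e (cong proj₁ (sym eq)))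

dsrc-injective : ∀ {n k} (t : Tm n k) {d d'} → portKey (dsrc t d) ≡ portKey (dsrc t d') → d ≡ d'
dsrc-injective t {e , b} {e' , b'} eq
  with not-injective (trans (sym (dsrc-isIn t (e , b))) (trans (cong (proj₁ ∘ proj₂) eq) (dsrc-isIn t (e' , b'))))
... | refl = cong (_, b) (dsrc-edge-injective t b eq)

f-leg-isIn : ∀ {K} (ℓ : Leg (kIn K) (kOut K)) → K ≡ gen gf → isIn ℓ ≡ true
f-leg-isIn (lin _)   refl = refl
f-leg-isIn (lout ()) refl

dsrc-gf⇒down : ∀ {n k} (t : Tm n k) (d : Dart t) {x} → proj₁ (dsrc t d) ≡ inn x → ikind t x ≡ gen gf →
               proj₂ d ≡ false
dsrc-gf⇒down t (e , false) _  _   = refl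
dsrc-gf⇒down t (e , true)  eq isF =
  contradiction (trans (sym (leg-isIn (dsrc t (e , true)) eq isF)) (dsrc-isIn t (e , true))) λ ()
  where
  leg-isIn : ∀ (P : Port t) {x} → proj₁ P ≡ inn x → ikind t x ≡ gen gf → isIn (proj₂ P) ≡ true
  leg-isIn (_ , ℓ) refl = f-leg-isIn ℓ

module _ {n k} (t : Tm n k) where
  flip : Dart t → Dart t
  flip (e , b) = e , not b

  dtgt≡dsrc-flip : ∀ d → dtgt t d ≡ dsrc t (flip d)
  dtgt≡dsrc-flip (e , true)  = refl
  dtgt≡dsrc-flip (e , false) = refl

  -- Unless d' retraces d, the two darts meet the node through different legs.
  turn-isOdd : ∀ d d' → proj₁ (dsrc t d') ≡ proj₁ (dtgt t d) → d' ≢ flip d →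
               isOddℤ (turnLeg (proj₂ (dtgt t d)) (proj₂ (dsrc t d'))) ≡ proj₂ d xor proj₂ d'
  turn-isOdd d d' same-node not-retraced = begin
    isOddℤ (turnLeg ℓ ℓ')              ≡⟨ turnLeg-isOdd ℓ ℓ' different-legs ⟩
    isIn ℓ xor not (isIn ℓ')           ≡⟨ cong₂ (λ u v → u xor not v) (dtgt-isIn t d) (dsrc-isIn t d') ⟩
    proj₂ d xor not (not (proj₂ d'))   ≡⟨ cong (proj₂ d xor_) (not-involutive (proj₂ d')) ⟩
    proj₂ d xor proj₂ d'               ∎
    where
    ℓ : LegAt t (proj₁ (dtgt t d))
    ℓ = proj₂ (dtgt t d)
    ℓ' : LegAt t (proj₁ (dsrc t d'))
    ℓ' = proj₂ (dsrc t d')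
    different-legs : legKey ℓ ≢ legKey ℓ'
    different-legs eq = not-retraced (dsrc-injective t
      (trans (cong₂ _,_ same-node (sym eq)) (cong portKey (dtgt≡dsrc-flip d))))

  lastDart : ∀ {x y} → Dart t → Walk t x y → Dart t
  lastDart d nil          = d
  lastDart _ (cons d _ w) = lastDart d w

  dtgt-lastDart : ∀ {y} d (w : Walk t (proj₁ (dtgt t d)) y) → proj₁ (dtgt t (lastDart d w)) ≡ y
  dtgt-lastDart d nil          = refl
  dtgt-lastDart _ (cons d _ w) = dtgt-lastDart d w

  Backtracks : ∀ {x y} → Walk t x y → Set
  Backtracks nil                      = ⊥
  Backtracks (cons _ _ nil)           = ⊥
  Backtracks (cons d _ (cons d' q w)) = d' ≡ flip d ⊎ Backtracks (cons d' q w)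

  backtracks-shorten : ∀ {x y} (w : Walk t x y) → Backtracks w → Σ (Walk t x y) λ w' → len w' < len w
  backtracks-shorten (cons (e , true)  refl (cons _ _ w)) (inj₁ refl) = w , m<n⇒m<1+n (n<1+n (len w))
  backtracks-shorten (cons (e , false) refl (cons _ _ w)) (inj₁ refl) = w , m<n⇒m<1+n (n<1+n (len w))
  backtracks-shorten (cons d p (cons d' q w)) (inj₂ bt) with backtracks-shorten (cons d' q w) bt
  ... | w' , shorter = cons d p w' , s≤s shorter

  shortest⇒¬backtracks : ∀ {x y} {w : Walk t x y} → Shortest w → ¬ Backtracks w
  shortest⇒¬backtracks {w = w} shortest bt with backtracks-shorten w bt
  ... | w' , shorter = <⇒≱ shorter (shortest w')

  tw-isOdd : ∀ {x y} d (p : proj₁ (dsrc t d) ≡ x) (w : Walk t (proj₁ (dtgt t d)) y) →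
             ¬ Backtracks (cons d p w) → isOddℤ (tw (cons d p w)) ≡ proj₂ d xor proj₂ (lastDart d w)
  tw-isOdd d p nil           _     = sym (xor-same (proj₂ d))
  tw-isOdd d p (cons d' q w) no-bt = begin
    isOddℤ (turn ℤ.+ tw (cons d' q w))
      ≡⟨ isOddℤ-+ turn _ ⟩
    isOddℤ turn xor isOddℤ (tw (cons d' q w))
      ≡⟨ cong₂ _xor_ (turn-isOdd d d' q (no-bt ∘ inj₁)) (tw-isOdd d' q w (no-bt ∘ inj₂)) ⟩
    (proj₂ d xor proj₂ d') xor (proj₂ d' xor proj₂ (lastDart d' w))
      ≡⟨ xor-cancel-middle (proj₂ d) (proj₂ d') _ ⟩
    proj₂ d xor proj₂ (lastDart d' w)
      ∎
    where
    turn : ℤ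
    turn = turnLeg (proj₂ (dtgt t d)) (proj₂ (dsrc t d'))

  tw-from-f-to-output : ∀ {x j} (w : Walk t (inn x) (bout j)) → ikind t x ≡ gen gf → ¬ Backtracks w →
                        isOddℤ (tw w) ≡ true
  tw-from-f-to-output (cons d p w) isF no-bt = begin
    isOddℤ (tw (cons d p w))         ≡⟨ tw-isOdd d p w no-bt ⟩
    proj₂ d xor proj₂ (lastDart d w) ≡⟨ cong₂ _xor_ (dsrc-gf⇒down t d p isF)
                                                    (dtgt-bout⇒up t (lastDart d w) (dtgt-lastDart d w)) ⟩
    false xor true                   ∎

  ¬¬-shortest : ∀ {x y} → Walk t x y → ¬ ¬ Σ (Walk t x y) Shortest
  ¬¬-shortest w no-shortest =
    ¬¬-least {P = λ m → Σ (Walk t _ _) λ w → len w ≡ m} (w , refl)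
      λ { (_ , (w' , len≡m) , least) →
            no-shortest (w' , λ w'' → subst (_≤ len w'') (sym len≡m) (least (len w'') (w'' , refl))) }

mainTheorem9 : ∀ {n} (t : Tm n 1) → Simple t → Untwisted t → HasNoF t
mainTheorem9 t (connected , _) untwisted x isF =
  ¬¬-shortest t (connected (inn x) (bout zero)) λ (w , shortest) →
    contradiction
      (trans (sym (tw-from-f-to-output t w isF (shortest⇒¬backtracks t shortest)))
             (cong isOddℤ (untwisted x (subst IsMUF (sym isF) tt) w shortest)))
      λ ()
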